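{- For every $k\ge2$ there is a graph $G$ with $\mathrm{ctdw}(G)\le5$ and $\mathrm{rtdw}(G)\ge k$.
   Context: A strong tree decomposition of $G=(V,E)$ is $(\{X_i\}_{i\in I},T=(I,F))$ where $\{X_i\}$ partitions $V$ and $T$ is a tree such that each edge has both ends in one bag or in bags of two adjacent tree nodes; its width is the maximum bag size. A tree distance decomposition is a strong tree decomposition with root $r$ such that each $v\in X_i$, $i\neq r$, has a neighbor in the bag of the parent of $i$. $\mathrm{ctdw}(G)$ (root-connected tree distance width) is the minimum width of a tree distance decomposition whose root bag induces a connected subgraph; $\mathrm{rtdw}(G)$ (rooted tree distance width) is the minimum width of a tree distance decomposition whose root bag consists of a single vertex. -}

module Defs where

open import Data.Nat using (ℕ; zero; suc; _≤_)
open import Data.Fin using (Fin; _≟_)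
open import Data.Fin.Base using ()
open import Data.List using (List; length; filter; allFin)
open import Data.Bool using (Bool; true; false)
open import Data.Product using (Σ; ∃; _×_; _,_)
open import Data.Sum using (_⊎_)
open import Relation.Binary.PropositionalEquality using (_≡_; _≢_)

record Graph : Set where
  field
    n     : ℕ
    adj   : Fin n → Fin n → Bool
    sym   : ∀ u v → adj u v ≡ adj v u
    loopless : ∀ v → adj v v ≡ false

open Graph public

Edge : (G : Graph) → Fin (n G) → Fin (n G) → Set
Edge G u v = adj G u v ≡ true

iter : ∀ {A : Set} → (A → A) → ℕ → A → A
iter f zero    x = x
iter f (suc k) x = f (iter f k x)

-- A rooted tree on node set Fin m, given by a parent map:
-- the root is its own parent and every node reaches the root.
-- (Tree edges are the pairs {i, parent i} with i ≠ root.)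
record RootedTree : Set where
  field
    m       : ℕ
    root    : Fin m
    parent  : Fin m → Fin m
    parent-root : parent root ≡ root
    reaches : ∀ i → ∃ λ k → iter parent k i ≡ root

open RootedTree public

TreeAdj : (T : RootedTree) → Fin (m T) → Fin (m T) → Set
TreeAdj T i j = (i ≢ j) × ((parent T i ≡ j) ⊎ (parent T j ≡ i))

-- A tree distance decomposition of G: a rooted tree T with a map
-- assigning every vertex to its bag; bags form a partition (the map is
-- surjective, i.e. all bags nonempty).
record TDD (G : Graph) : Set where
  field
    tree   : RootedTree
    bag    : Fin (n G) → Fin (m tree)
    bags-nonempty : ∀ i → ∃ λ v → bag v ≡ i
    edge-ok : ∀ u v → Edge G u v → (bag u ≡ bag v) ⊎ TreeAdj tree (bag u) (bag v)
    dist-ok : ∀ v → bag v ≢ root tree →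
              ∃ λ u → Edge G v u × (bag u ≡ parent tree (bag v))

open TDD public

bagSize : ∀ {G : Graph} (D : TDD G) → Fin (m (tree D)) → ℕ
bagSize {G} D i = length (filter (λ v → bag D v ≟ i) (allFin (n G)))

WidthAtMost : ∀ {G : Graph} → TDD G → ℕ → Set
WidthAtMost D w = ∀ i → bagSize D i ≤ w

WidthAtLeast : ∀ {G : Graph} → TDD G → ℕ → Set
WidthAtLeast D w = ∃ λ i → w ≤ bagSize D i

data ReachIn (G : Graph) (S : Fin (n G) → Set) : Fin (n G) → Fin (n G) → Set where
  here : ∀ {u} → ReachIn G S u u
  step : ∀ {u v w} → Edge G u v → S v → ReachIn G S v w → ReachIn G S u w

RootConnected : ∀ {G : Graph} → TDD G → Set
RootConnected {G} D =
  ∀ u w → bag D u ≡ root (tree D) → bag D w ≡ root (tree D) →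
  ReachIn G (λ x → bag D x ≡ root (tree D)) u w

RootSingleton : ∀ {G : Graph} → TDD G → Set
RootSingleton D = bagSize D (root (tree D)) ≡ 1

ctdw≤ : Graph → ℕ → Set
ctdw≤ G w = Σ (TDD G) λ D → RootConnected D × WidthAtMost D w

rtdw≥ : Graph → ℕ → Set
rtdw≥ G k = ∀ (D : TDD G) → RootSingleton D → WidthAtLeast D k

-- The graph is an edge AB together with k + 1 ears A – Xⱼ – Yⱼ – B.  The root
-- bag {A, B} with one child bag {Xⱼ, Yⱼ} per ear is a root-connected tree
-- distance decomposition of width 2.  If instead the root bag is a single
-- vertex then, by the symmetry A ↔ B, Xⱼ ↔ Yⱼ, it is A or some Xᵢ.  Either way,
-- for all ears but at most one the bags of B and of Xⱼ are children of a common
-- node p (the root, resp. the bag of A), while Yⱼ is adjacent to both and not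
-- in p; in a tree this puts Xⱼ into the bag of B, which so has at least k
-- vertices.
module Submission where

open import Defs
open import Data.Nat using (ℕ; zero; suc; _+_; _≤_; z≤n; s≤s)
open import Data.Product using (Σ; ∃; _×_; _,_; proj₁; proj₂)
open import Data.Bool using (Bool; true; false)
open import Data.Empty using (⊥-elim)
open import Data.Fin using (Fin; zero; suc; _≟_; splitAt; join; _↑ˡ_; _↑ʳ_; punchIn)
open import Data.Fin.Properties using (pigeonhole; splitAt-↑ˡ; splitAt-↑ʳ; join-splitAt; punchIn-injective; punchInᵢ≢i; <⇒≢; suc-injective)
open import Data.List using (List; []; _∷_; length; lookup; allFin; tabulate)
open import Data.List.Membership.Propositional using (_∈_)
open import Data.List.Membership.Propositional.Properties using (∈-filter⁺; ∈-filter⁻; ∈-lookup; ∈-allFin)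
open import Data.List.Properties using (length-tabulate)
open import Data.List.Relation.Binary.Subset.Propositional using (_⊆_)
open import Data.List.Relation.Unary.All as All using (All)
open import Data.List.Relation.Unary.All.Properties using (tabulate⁺)
open import Data.List.Relation.Unary.AllPairs using ([]; _∷_)
open import Data.List.Relation.Unary.Any using (here; there; index)
open import Data.List.Relation.Unary.Any.Properties using (lookup-index)
open import Data.List.Relation.Unary.Unique.Propositional using (Unique)
import Data.List.Relation.Unary.Unique.Propositional.Properties as Unique
open import Data.Nat.Properties using (_≤?_; ≰⇒>; <-irrefl; ≤-trans)
open import Data.Sum using (_⊎_; inj₁; inj₂)
open import Function.Bundles using (mk⇔)
open import Relation.Nullary using (¬_; yes; no; does; contradiction)
open import Relation.Nullary.Decidable using (dec-true; dec-false; does-⇔)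
open import Relation.Binary.PropositionalEquality as ≡ using (_≡_; _≢_; refl; trans; cong; cong₂; subst; subst₂)

Unique⇒lookup-injective : ∀ {A : Set} {xs : List A} → Unique xs →
                          ∀ i j → lookup xs i ≡ lookup xs j → i ≡ j
Unique⇒lookup-injective (_   ∷ _) zero    zero    _ = refl
Unique⇒lookup-injective (x∉ ∷ _) zero    (suc j) e = ⊥-elim (All.lookup x∉ (∈-lookup j) e)
Unique⇒lookup-injective (x∉ ∷ _) (suc i) zero    e = ⊥-elim (All.lookup x∉ (∈-lookup i) (≡.sym e))
Unique⇒lookup-injective (_   ∷ u) (suc i) (suc j) e = cong suc (Unique⇒lookup-injective u i j e)

Unique-⊆⇒length-≤ : ∀ {A : Set} {xs ys : List A} → Unique xs → xs ⊆ ys → length xs ≤ length ys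
Unique-⊆⇒length-≤ {xs = xs} {ys} u xs⊆ys with length xs ≤? length ys
... | yes xs≤ys = xs≤ys
... | no xs≰ys with pigeonhole (≰⇒> xs≰ys) (λ i → index (xs⊆ys (∈-lookup i)))
...   | i , j , i<j , same-index = contradiction (Unique⇒lookup-injective u i j xsᵢ≡xsⱼ) (<⇒≢ i<j)
  where
    xsᵢ≡xsⱼ : lookup xs i ≡ lookup xs j
    xsᵢ≡xsⱼ = trans (lookup-index (xs⊆ys (∈-lookup i)))
                (trans (cong (lookup ys) same-index) (≡.sym (lookup-index (xs⊆ys (∈-lookup j)))))

module _ {G : Graph} (D : TDD G) where

  bagSize-≤ : ∀ {i} (vs : List (Fin (n G))) → (∀ {v} → bag D v ≡ i → v ∈ vs) → bagSize D i ≤ length vs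
  bagSize-≤ {i} vs bag⊆vs =
    Unique-⊆⇒length-≤ (Unique.filter⁺ (λ v → bag D v ≟ i) (Unique.allFin⁺ (n G)))
                      (λ v∈ → bag⊆vs (proj₂ (∈-filter⁻ (λ v → bag D v ≟ i) {xs = allFin (n G)} v∈)))

  ≤-bagSize : ∀ {i} {vs : List (Fin (n G))} → Unique vs → All (λ v → bag D v ≡ i) vs →
              length vs ≤ bagSize D i
  ≤-bagSize {i} u in-bag =
    Unique-⊆⇒length-≤ u (λ v∈ → ∈-filter⁺ (λ v → bag D v ≟ i) (∈-allFin _) (All.lookup in-bag v∈))

Child : (T : RootedTree) → Fin (m T) → Fin (m T) → Set
Child T q p = (parent T q ≡ p) × (q ≢ p)

Near : (T : RootedTree) → Fin (m T) → Fin (m T) → Set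
Near T a b = (a ≡ b) ⊎ TreeAdj T a b

module _ (T : RootedTree) where

  near-child⇒≡∨child : ∀ {p q s} → Child T q p → s ≢ p → Near T s q → (s ≡ q) ⊎ (parent T s ≡ q)
  near-child⇒≡∨child _       _   (inj₁ s≡q)             = inj₁ s≡q
  near-child⇒≡∨child _       _   (inj₂ (_ , inj₁ up))   = inj₂ up
  near-child⇒≡∨child (q↑ , _) s≢p (inj₂ (_ , inj₂ down)) = ⊥-elim (s≢p (trans (≡.sym down) q↑))

  near-children⇒≡ : ∀ {p q₁ q₂ s} → Child T q₁ p → Child T q₂ p → s ≢ p →
                    Near T s q₁ → Near T s q₂ → q₁ ≡ q₂
  near-children⇒≡ c₁ c₂ s≢p n₁ n₂
    with near-child⇒≡∨child c₁ s≢p n₁ | near-child⇒≡∨child c₂ s≢p n₂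
  ... | inj₁ s≡q₁ | inj₁ s≡q₂ = trans (≡.sym s≡q₁) s≡q₂
  ... | inj₂ s↑q₁ | inj₂ s↑q₂ = trans (≡.sym s↑q₁) s↑q₂
  ... | inj₁ s≡q₁ | inj₂ s↑q₂ =
    ⊥-elim (proj₂ c₂ (trans (≡.sym s↑q₂) (trans (cong (parent T) s≡q₁) (proj₁ c₁))))
  ... | inj₂ s↑q₁ | inj₁ s≡q₂ =
    ⊥-elim (proj₂ c₁ (trans (≡.sym s↑q₁) (trans (cong (parent T) s≡q₂) (proj₁ c₂))))

module SingletonRoot {G : Graph} (D : TDD G) (single : RootSingleton D)
                     (r : Fin (n G)) (r∈root : bag D r ≡ root (tree D)) where

  private
    T = tree D
    ρ = root T

  in-root⇒≡r : ∀ {v} → bag D v ≡ ρ → v ≡ r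
  in-root⇒≡r {v} v∈root with v ≟ r
  ... | yes v≡r = v≡r
  ... | no v≢r = contradiction two≤one (<-irrefl refl)
    where
      two≤one : 2 ≤ 1
      two≤one = subst (2 ≤_) single
                  (≤-bagSize D ((v≢r All.∷ All.[]) ∷ All.[] ∷ []) (v∈root All.∷ r∈root All.∷ All.[]))

  ≢r⇒∉root : ∀ {v} → v ≢ r → bag D v ≢ ρ
  ≢r⇒∉root v≢r v∈root = v≢r (in-root⇒≡r v∈root)

  neighbour-of-r⇒child-of-root : ∀ {v} → Edge G v r → v ≢ r → Child T (bag D v) ρ
  neighbour-of-r⇒child-of-root {v} e v≢r with edge-ok D v r e
  ... | inj₁ same            = ⊥-elim (≢r⇒∉root v≢r (trans same r∈root))
  ... | inj₂ (_ , inj₁ up)   = trans up r∈root , ≢r⇒∉root v≢r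
  ... | inj₂ (_ , inj₂ down) =
    ⊥-elim (≢r⇒∉root v≢r (trans (≡.sym down) (trans (cong (parent T) r∈root) (parent-root T))))

  child-of-root⇒neighbour-of-r : ∀ {v} → Child T (bag D v) ρ → Edge G v r
  child-of-root⇒neighbour-of-r {v} (up , v∉root) with dist-ok D v v∉root
  ... | u , e , u∈parent = subst (Edge G v) (in-root⇒≡r (trans u∈parent up)) e

  neighbour⇒grandchild : ∀ {v w} → Edge G v w → Child T (bag D w) ρ → ¬ Edge G v r → v ≢ r →
                         Child T (bag D v) (bag D w)
  neighbour⇒grandchild {v} {w} e w-child ¬vr v≢r with edge-ok D v w e
  ... | inj₁ same            =
    ⊥-elim (¬vr (child-of-root⇒neighbour-of-r (subst (λ q → Child T q ρ) (≡.sym same) w-child)))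
  ... | inj₂ (v≢w , inj₁ up) = up , v≢w
  ... | inj₂ (_ , inj₂ down) = ⊥-elim (≢r⇒∉root v≢r (trans (≡.sym down) (proj₁ w-child)))

data EarVertex (M : ℕ) : Set where
  A B : EarVertex M
  X Y : Fin M → EarVertex M

ear-adj : ∀ {M} → EarVertex M → EarVertex M → Bool
ear-adj A     A     = false
ear-adj A     B     = true
ear-adj A     (X _) = true
ear-adj A     (Y _) = false
ear-adj B     A     = true
ear-adj B     B     = false
ear-adj B     (X _) = false
ear-adj B     (Y _) = true
ear-adj (X _) A     = true
ear-adj (X _) B     = false
ear-adj (X _) (X _) = false
ear-adj (X i) (Y j) = does (i ≟ j)
ear-adj (Y _) A     = false
ear-adj (Y _) B     = true
ear-adj (Y i) (X j) = does (i ≟ j)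
ear-adj (Y _) (Y _) = false

ear-adj-sym : ∀ {M} (u v : EarVertex M) → ear-adj u v ≡ ear-adj v u
ear-adj-sym A     A     = refl
ear-adj-sym A     B     = refl
ear-adj-sym A     (X _) = refl
ear-adj-sym A     (Y _) = refl
ear-adj-sym B     A     = refl
ear-adj-sym B     B     = refl
ear-adj-sym B     (X _) = refl
ear-adj-sym B     (Y _) = refl
ear-adj-sym (X _) A     = refl
ear-adj-sym (X _) B     = refl
ear-adj-sym (X _) (X _) = refl
ear-adj-sym (X i) (Y j) = does-⇔ (mk⇔ ≡.sym ≡.sym) (i ≟ j) (j ≟ i)
ear-adj-sym (Y _) A     = refl
ear-adj-sym (Y _) B     = refl
ear-adj-sym (Y i) (X j) = does-⇔ (mk⇔ ≡.sym ≡.sym) (i ≟ j) (j ≟ i)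
ear-adj-sym (Y _) (Y _) = refl

ear-adj-irrefl : ∀ {M} (v : EarVertex M) → ear-adj v v ≡ false
ear-adj-irrefl A     = refl
ear-adj-irrefl B     = refl
ear-adj-irrefl (X _) = refl
ear-adj-irrefl (Y _) = refl

ear-adj-X-Y : ∀ {M} (i j : Fin M) → ear-adj (X i) (Y j) ≡ true → i ≡ j
ear-adj-X-Y i j _  with i ≟ j
ear-adj-X-Y i j _  | yes i≡j = i≡j
ear-adj-X-Y i j () | no _

swap : ∀ {M} → EarVertex M → EarVertex M
swap A     = B
swap B     = A
swap (X j) = Y j
swap (Y j) = X j

swap-involutive : ∀ {M} (v : EarVertex M) → swap (swap v) ≡ v
swap-involutive A     = refl
swap-involutive B     = refl
swap-involutive (X _) = refl
swap-involutive (Y _) = refl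

swap-injective : ∀ {M} {u v : EarVertex M} → swap u ≡ swap v → u ≡ v
swap-injective {u = u} {v} e = trans (≡.sym (swap-involutive u)) (trans (cong swap e) (swap-involutive v))

ear-adj-swap : ∀ {M} (u v : EarVertex M) → ear-adj (swap u) (swap v) ≡ ear-adj u v
ear-adj-swap A     A     = refl
ear-adj-swap A     B     = refl
ear-adj-swap A     (X _) = refl
ear-adj-swap A     (Y _) = refl
ear-adj-swap B     A     = refl
ear-adj-swap B     B     = refl
ear-adj-swap B     (X _) = refl
ear-adj-swap B     (Y _) = refl
ear-adj-swap (X _) A     = refl
ear-adj-swap (X _) B     = refl
ear-adj-swap (X _) (X _) = refl
ear-adj-swap (X _) (Y _) = refl
ear-adj-swap (Y _) A     = refl
ear-adj-swap (Y _) B     = refl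
ear-adj-swap (Y _) (X _) = refl
ear-adj-swap (Y _) (Y _) = refl

order : ℕ → ℕ
order M = 2 + (M + M)

-- Vertex numbering: A = 0, B = 1, X j = 2 + j, Y j = 2 + M + j.
decode : ∀ {M} → Fin (order M) → EarVertex M
decode zero                = A
decode (suc zero)          = B
decode {M} (suc (suc i)) with splitAt M i
... | inj₁ j = X j
... | inj₂ j = Y j

encode : ∀ {M} → EarVertex M → Fin (order M)
encode     A     = zero
encode     B     = suc zero
encode {M} (X j) = suc (suc (j ↑ˡ M))
encode {M} (Y j) = suc (suc (M ↑ʳ j))

decode-encode : ∀ {M} (v : EarVertex M) → decode (encode v) ≡ v
decode-encode     A     = refl
decode-encode     B     = refl
decode-encode {M} (X j) rewrite splitAt-↑ˡ M j M = refl
decode-encode {M} (Y j) rewrite splitAt-↑ʳ M M j = refl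

encode-decode : ∀ {M} (i : Fin (order M)) → encode (decode {M} i) ≡ i
encode-decode     zero          = refl
encode-decode     (suc zero)    = refl
encode-decode {M} (suc (suc i)) with splitAt M i in eq
... | inj₁ j = cong (λ l → suc (suc l)) (trans (cong (join M M) (≡.sym eq)) (join-splitAt M M i))
... | inj₂ j = cong (λ l → suc (suc l)) (trans (cong (join M M) (≡.sym eq)) (join-splitAt M M i))

encode-injective : ∀ {M} {u v : EarVertex M} → encode u ≡ encode v → u ≡ v
encode-injective {u = u} {v} e = trans (≡.sym (decode-encode u)) (trans (cong decode e) (decode-encode v))

earGraph : ℕ → Graph
earGraph M = record
  { n        = order M
  ; adj      = λ u v → ear-adj (decode {M} u) (decode {M} v)
  ; sym      = λ u v → ear-adj-sym (decode {M} u) (decode {M} v)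
  ; loopless = λ v → ear-adj-irrefl (decode {M} v)
  }

adj-encode : ∀ {M} (u v : EarVertex M) → adj (earGraph M) (encode u) (encode v) ≡ ear-adj u v
adj-encode u v = cong₂ ear-adj (decode-encode u) (decode-encode v)

star : ℕ → RootedTree
star M = record
  { m = suc M ; root = zero ; parent = λ _ → zero
  ; parent-root = refl ; reaches = λ _ → 1 , refl }

module EarDecomposition (M : ℕ) where

  earBag : EarVertex M → Fin (suc M)
  earBag A     = zero
  earBag B     = zero
  earBag (X j) = suc j
  earBag (Y j) = suc j

  earBag-edge : ∀ u v → ear-adj u v ≡ true → Near (star M) (earBag u) (earBag v)
  earBag-edge A     B     _ = inj₁ refl
  earBag-edge A     (X _) _ = inj₂ ((λ ()) , inj₂ refl)
  earBag-edge B     A     _ = inj₁ refl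
  earBag-edge B     (Y _) _ = inj₂ ((λ ()) , inj₂ refl)
  earBag-edge (X _) A     _ = inj₂ ((λ ()) , inj₁ refl)
  earBag-edge (X i) (Y j) e = inj₁ (cong suc (ear-adj-X-Y i j e))
  earBag-edge (Y _) B     _ = inj₂ ((λ ()) , inj₁ refl)
  earBag-edge (Y i) (X j) e = inj₁ (cong suc (≡.sym (ear-adj-X-Y j i (trans (ear-adj-sym (X j) (Y i)) e))))
  earBag-edge A     A     ()
  earBag-edge A     (Y _) ()
  earBag-edge B     B     ()
  earBag-edge B     (X _) ()
  earBag-edge (X _) B     ()
  earBag-edge (X _) (X _) ()
  earBag-edge (Y _) A     ()
  earBag-edge (Y _) (Y _) ()

  earBag-toward-root : ∀ v → earBag v ≢ zero → ∃ λ u → (ear-adj v u ≡ true) × (earBag u ≡ zero)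
  earBag-toward-root A     A∉root = ⊥-elim (A∉root refl)
  earBag-toward-root B     B∉root = ⊥-elim (B∉root refl)
  earBag-toward-root (X _) _      = A , refl , refl
  earBag-toward-root (Y _) _      = B , refl , refl

  decomposition : TDD (earGraph M)
  decomposition = record
    { tree          = star M
    ; bag           = λ v → earBag (decode v)
    ; bags-nonempty = λ { zero    → encode {M} A , refl
                        ; (suc j) → encode (X j) , cong earBag (decode-encode (X j)) }
    ; edge-ok       = λ u v → earBag-edge (decode u) (decode v)
    ; dist-ok       = toward-root
    }
    where
      toward-root : ∀ v → earBag (decode v) ≢ zero →
                    ∃ λ u → Edge (earGraph M) v u × (earBag (decode u) ≡ zero)
      toward-root v v∉root with earBag-toward-root (decode v) v∉root
      ... | u , e , u∈root = encode u , trans (cong (ear-adj (decode v)) (decode-encode u)) e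
                                      , trans (cong earBag (decode-encode u)) u∈root

  root-connected : RootConnected decomposition
  root-connected u w u∈root w∈root =
    subst₂ (ReachIn (earGraph M) _) (encode-decode u) (encode-decode w)
           (reach (decode u) (decode w) u∈root w∈root)
    where
      reach : ∀ a b → earBag a ≡ zero → earBag b ≡ zero →
              ReachIn (earGraph M) (λ x → earBag (decode x) ≡ zero) (encode a) (encode b)
      reach A A _ _ = here
      reach A B _ _ = step refl refl here
      reach B A _ _ = step refl refl here
      reach B B _ _ = here
      reach (X _) _     () _
      reach (Y _) _     () _
      reach A     (X _) _  ()
      reach A     (Y _) _  ()
      reach B     (X _) _  ()
      reach B     (Y _) _  ()

  bagMembers : Fin (suc M) → List (Fin (order M))
  bagMembers zero    = encode {M} A ∷ encode {M} B ∷ []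
  bagMembers (suc j) = encode (X j) ∷ encode (Y j) ∷ []

  ∈-bagMembers : ∀ v i → earBag v ≡ i → encode v ∈ bagMembers i
  ∈-bagMembers A     zero     refl = here refl
  ∈-bagMembers B     zero     refl = there (here refl)
  ∈-bagMembers (X j) (suc .j) refl = here refl
  ∈-bagMembers (Y j) (suc .j) refl = there (here refl)

  width≤2 : WidthAtMost decomposition 2
  width≤2 i = ≤-trans (bagSize-≤ decomposition (bagMembers i) in-bag) (two-members i)
    where
      in-bag : ∀ {v} → earBag (decode v) ≡ i → v ∈ bagMembers i
      in-bag {v} v∈i = subst (_∈ bagMembers i) (encode-decode v) (∈-bagMembers (decode v) i v∈i)
      two-members : ∀ i → length (bagMembers i) ≤ 2
      two-members zero    = s≤s (s≤s z≤n)
      two-members (suc _) = s≤s (s≤s z≤n)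

  ctdw≤5 : ctdw≤ (earGraph M) 5
  ctdw≤5 = decomposition , root-connected , λ i → ≤-trans (width≤2 i) (s≤s (s≤s z≤n))

X-injective : ∀ {M} {i j : Fin M} → X i ≡ X j → i ≡ j
X-injective refl = refl

module SingletonRootDecomposition (k : ℕ) (D : TDD (earGraph (suc k))) (single : RootSingleton D) where

  private
    M = suc k
    G = earGraph M
    T = tree D
    ρ = root T

  -- Roots at B and at Y i reduce to roots at A and at X i through the automorphism swap.
  module UpToAutomorphism (σ : EarVertex M → EarVertex M)
                          (σ-adj : ∀ u v → ear-adj (σ u) (σ v) ≡ ear-adj u v)
                          (σ-injective : ∀ {u v} → σ u ≡ σ v → u ≡ v) where

    ⟦_⟧ : EarVertex M → Fin (order M)
    ⟦ v ⟧ = encode (σ v)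

    β : EarVertex M → Fin (m T)
    β v = bag D ⟦ v ⟧

    adj-⟦⟧ : ∀ u v → adj G ⟦ u ⟧ ⟦ v ⟧ ≡ ear-adj u v
    adj-⟦⟧ u v = trans (adj-encode (σ u) (σ v)) (σ-adj u v)

    edge : ∀ u v → ear-adj u v ≡ true → Edge G ⟦ u ⟧ ⟦ v ⟧
    edge u v uv = trans (adj-⟦⟧ u v) uv

    non-edge : ∀ u v → ear-adj u v ≡ false → ¬ Edge G ⟦ u ⟧ ⟦ v ⟧
    non-edge u v ¬uv uv with () ← trans (≡.sym uv) (trans (adj-⟦⟧ u v) ¬uv)

    ⟦⟧-injective : ∀ {u v} → ⟦ u ⟧ ≡ ⟦ v ⟧ → u ≡ v
    ⟦⟧-injective e = σ-injective (encode-injective e)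

    distinct : ∀ {u v} → u ≢ v → ⟦ u ⟧ ≢ ⟦ v ⟧
    distinct u≢v e = u≢v (⟦⟧-injective e)

    ear-joins-bag-of-B : ∀ {p} j → Child T (β B) p → Child T (β (X j)) p → β (Y j) ≢ p → β (X j) ≡ β B
    ear-joins-bag-of-B j B-child X-child Y∉p =
      near-children⇒≡ T X-child B-child Y∉p
        (edge-ok D ⟦ Y j ⟧ ⟦ X j ⟧ (edge (Y j) (X j) (dec-true (j ≟ j) refl)))
        (edge-ok D ⟦ Y j ⟧ ⟦ B ⟧ (edge (Y j) B refl))

    ears-in-bag-of-B⇒wide : (I : Fin k → Fin M) → (∀ {a b} → I a ≡ I b → a ≡ b) →
                            (∀ j → β (X (I j)) ≡ β B) → WidthAtLeast D k
    ears-in-bag-of-B⇒wide I I-injective X∈B =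
      β B , subst (_≤ bagSize D (β B)) (length-tabulate (λ j → ⟦ X (I j) ⟧))
                  (≤-bagSize D (Unique.tabulate⁺ (λ e → I-injective (X-injective (⟦⟧-injective e))))
                               (tabulate⁺ X∈B))

    root-at-A : β A ≡ ρ → WidthAtLeast D k
    root-at-A A∈root = ears-in-bag-of-B⇒wide suc suc-injective λ j →
      ear-joins-bag-of-B (suc j) (child-of-A B refl (λ ())) (child-of-A (X (suc j)) refl (λ ()))
                         (≢r⇒∉root (distinct λ ()))
      where
        open SingletonRoot D single ⟦ A ⟧ A∈root
        child-of-A : ∀ v → ear-adj v A ≡ true → v ≢ A → Child T (β v) ρ
        child-of-A v vA v≢A = neighbour-of-r⇒child-of-root (edge v A vA) (distinct v≢A)

    root-at-X : ∀ i → β (X i) ≡ ρ → WidthAtLeast D k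
    root-at-X i Xᵢ∈root = ears-in-bag-of-B⇒wide (punchIn i) (punchIn-injective i _ _) λ j →
      ear-joins-bag-of-B (punchIn i j) (grandchild B refl refl (λ ()))
        (grandchild (X (punchIn i j)) refl refl (λ e → punchInᵢ≢i i j (X-injective e)))
        (Y∉bag-of-A (punchIn i j) (punchInᵢ≢i i j))
      where
        open SingletonRoot D single ⟦ X i ⟧ Xᵢ∈root
        A-child : Child T (β A) ρ
        A-child = neighbour-of-r⇒child-of-root (edge A (X i) refl) (distinct λ ())
        grandchild : ∀ v → ear-adj v A ≡ true → ear-adj v (X i) ≡ false → v ≢ X i → Child T (β v) (β A)
        grandchild v vA ¬vXᵢ v≢Xᵢ =
          neighbour⇒grandchild (edge v A vA) A-child (non-edge v (X i) ¬vXᵢ) (distinct v≢Xᵢ)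
        Y∉bag-of-A : ∀ j → j ≢ i → β (Y j) ≢ β A
        Y∉bag-of-A j j≢i Y∈A = non-edge (Y j) (X i) (dec-false (j ≟ i) j≢i)
          (child-of-root⇒neighbour-of-r (subst (λ q → Child T q ρ) (≡.sym Y∈A) A-child))

  open UpToAutomorphism (λ v → v) (λ _ _ → refl) (λ e → e)
  module Swapped = UpToAutomorphism swap ear-adj-swap swap-injective

  root-vertex⇒wide : ∀ v → bag D (encode v) ≡ ρ → WidthAtLeast D k
  root-vertex⇒wide A     = root-at-A
  root-vertex⇒wide B     = Swapped.root-at-A
  root-vertex⇒wide (X i) = root-at-X i
  root-vertex⇒wide (Y i) = Swapped.root-at-X i

  wide : WidthAtLeast D k
  wide with r , r∈root ← bags-nonempty D ρ =
    root-vertex⇒wide (decode r) (trans (cong (bag D) (encode-decode r)) r∈root)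

-- The bound holds for every k.
theorem5 : ∀ (k : ℕ) → 2 ≤ k → Σ Graph (λ G → ctdw≤ G 5 × rtdw≥ G k)
theorem5 k _ = earGraph (suc k) , EarDecomposition.ctdw≤5 (suc k) , SingletonRootDecomposition.wide k
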